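{- For all words $x_1,x_2,y_1,y_2$: if $x_1x_2=y_1y_2$, then $x_2$ is a suffix of $y_2$ or $y_2$ is a suffix of $x_2$.
   Context: Work in a two-sorted first-order theory with equality whose sorts are words (lower-case variables) and systems (upper-case variables), with two word constants $0$ and $1$, a binary concatenation operation on words written by juxtaposition, and a membership relation $x\in S$ between a word and a system. Axioms: (symbols) $0\neq 1$ and $xy\neq 0$, $xy\neq 1$ for all words $x,y$; (associativity) $(xy)z=x(yz)$; (reading) $x0\neq y1$ for all $x,y$; (simplification) if $x_1y_1=x_2y_2$ and $y_1=y_2$ then $x_1=x_2$; (extensionality) two systems with the same elements are equal; (word induction) every system containing $0$ and $1$ and containing $x0$ and $x1$ whenever it contains $x$ contains every word; (comprehension) for every formula $\phi(x,x_1,\dots,x_n,S_1,\dots,S_m)$ in which $S$ is not free, there is a system $S$ with $x\in S\Leftrightarrow\phi$ for all words $x$. A word $x$ is a suffix of a word $y$ if $y=x$ or there is a word $z$ with $y=zx$. -}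

module Defs where

open import Data.Nat using (ℕ; suc)
open import Data.Fin using (Fin)
open import Data.Vec using (Vec; _∷_; lookup)
open import Data.Product using (Σ; _×_; ∃)
open import Data.Sum using (_⊎_)
open import Data.Empty using (⊥)
open import Relation.Nullary using (¬_)
open import Relation.Binary.PropositionalEquality using (_≡_; _≢_)
open import Function.Bundles using (_⇔_)

-- A structure for the two-sorted language: words W, systems S,
-- constants 0 and 1, concatenation, membership.
record Structure : Set₁ where
  field
    W   : Set
    S   : Set
    𝟎   : W
    𝟏   : W
    _·_ : W → W → W
    _∈_ : W → S → Set
  infixl 7 _·_
  infix 4 _∈_

-- First-order syntax (deep embedding) used for the comprehension schema.
-- n = number of free word variables, m = number of free system variables.
data Term (n : ℕ) : Set where
  var : Fin n → Term n
  c0  : Term n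
  c1  : Term n
  app : Term n → Term n → Term n

data Formula (n m : ℕ) : Set where
  eqW  : Term n → Term n → Formula n m
  eqS  : Fin m → Fin m → Formula n m
  mem  : Term n → Fin m → Formula n m
  fls  : Formula n m
  _and_ _or_ _imp_ : Formula n m → Formula n m → Formula n m
  allW exW : Formula (suc n) m → Formula n m
  allS exS : Formula n (suc m) → Formula n m

module Semantics (M : Structure) where
  open Structure M

  ⟦_⟧t : ∀ {n} → Term n → Vec W n → W
  ⟦ var i ⟧t ρ = lookup ρ i
  ⟦ c0 ⟧t ρ = 𝟎
  ⟦ c1 ⟧t ρ = 𝟏
  ⟦ app s t ⟧t ρ = ⟦ s ⟧t ρ · ⟦ t ⟧t ρ

  ⟦_⟧ : ∀ {n m} → Formula n m → Vec W n → Vec S m → Set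
  ⟦ eqW s t ⟧ ρ σ = ⟦ s ⟧t ρ ≡ ⟦ t ⟧t ρ
  ⟦ eqS i j ⟧ ρ σ = lookup σ i ≡ lookup σ j
  ⟦ mem t i ⟧ ρ σ = ⟦ t ⟧t ρ ∈ lookup σ i
  ⟦ fls ⟧ ρ σ = ⊥
  ⟦ φ and ψ ⟧ ρ σ = ⟦ φ ⟧ ρ σ × ⟦ ψ ⟧ ρ σ
  ⟦ φ or ψ ⟧ ρ σ = ⟦ φ ⟧ ρ σ ⊎ ⟦ ψ ⟧ ρ σ
  ⟦ φ imp ψ ⟧ ρ σ = ⟦ φ ⟧ ρ σ → ⟦ ψ ⟧ ρ σ
  ⟦ allW φ ⟧ ρ σ = (x : W) → ⟦ φ ⟧ (x ∷ ρ) σ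
  ⟦ exW φ ⟧ ρ σ = Σ W λ x → ⟦ φ ⟧ (x ∷ ρ) σ
  ⟦ allS φ ⟧ ρ σ = (X : S) → ⟦ φ ⟧ ρ (X ∷ σ)
  ⟦ exS φ ⟧ ρ σ = Σ S λ X → ⟦ φ ⟧ ρ (X ∷ σ)

record IsModel (M : Structure) : Set₁ where
  open Structure M
  open Semantics M
  field
    zero≢one   : 𝟎 ≢ 𝟏
    cat≢zero   : ∀ x y → x · y ≢ 𝟎
    cat≢one    : ∀ x y → x · y ≢ 𝟏
    assoc      : ∀ x y z → (x · y) · z ≡ x · (y · z)
    reading    : ∀ x y → x · 𝟎 ≢ y · 𝟏
    simplify   : ∀ x₁ y₁ x₂ y₂ → x₁ · y₁ ≡ x₂ · y₂ → y₁ ≡ y₂ → x₁ ≡ x₂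
    ext        : ∀ (X Y : S) → (∀ x → (x ∈ X ⇔ x ∈ Y)) → X ≡ Y
    induction  : ∀ (X : S) → 𝟎 ∈ X → 𝟏 ∈ X →
                 (∀ x → x ∈ X → (x · 𝟎 ∈ X) × (x · 𝟏 ∈ X)) →
                 ∀ x → x ∈ X
    comprehension : ∀ {n m} (φ : Formula (suc n) m) (ρ : Vec W n) (σ : Vec S m) →
                    Σ S λ X → ∀ x → (x ∈ X ⇔ ⟦ φ ⟧ (x ∷ ρ) σ)

module _ (M : Structure) where
  open Structure M
  IsSuffix : W → W → Set
  IsSuffix x y = (y ≡ x) ⊎ (Σ W λ z → y ≡ z · x)

module Submission where

-- Idea: peel letters off the right end.  Every word is either a letter
-- (0 or 1) or a word followed by a letter (a "last-letter view", obtained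
-- by word induction).  If w·b = v·c for letters b, c, then b = c by the
-- reading axiom and w = v by simplification.  So, by induction on x₂:
-- when x₂ is a letter, y₂ ends in the same letter and x₂ is a suffix of
-- y₂; when x₂ = w·c, either y₂ = c (a suffix of x₂) or y₂ = z·c with
-- x₁w = y₁z, and the induction hypothesis for w and z carries over to
-- w·c and z·c.
--
-- Word induction only applies to systems, so each induction is run on a
-- formula, via comprehension; the formulas below are chosen so that their
-- semantics is definitionally the predicate we want.

open import Defs
open import Data.Bool using (Bool; false; true)
open import Data.Empty using (⊥-elim)
open import Data.Fin using (Fin; zero; suc)
open import Data.Nat using (suc)
open import Data.Product using (Σ; _,_; _×_)
open import Data.Sum using (_⊎_; inj₁; inj₂)
open import Data.Vec using (Vec; []; _∷_)
open import Function.Bundles using (Equivalence)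
open import Relation.Binary.PropositionalEquality
  using (_≡_; refl; sym; trans)

module _ (M : Structure) (model : IsModel M) where
  open Structure M
  open IsModel model
  open Semantics M

  -- Word induction for every property expressible by a formula (with
  -- parameters): comprehension turns it into a system.
  formulaInduction : ∀ {n m} (φ : Formula (suc n) m) (ρ : Vec W n) (σ : Vec S m) →
    ⟦ φ ⟧ (𝟎 ∷ ρ) σ → ⟦ φ ⟧ (𝟏 ∷ ρ) σ →
    (∀ x → ⟦ φ ⟧ (x ∷ ρ) σ → ⟦ φ ⟧ (x · 𝟎 ∷ ρ) σ × ⟦ φ ⟧ (x · 𝟏 ∷ ρ) σ) →
    ∀ x → ⟦ φ ⟧ (x ∷ ρ) σ
  formulaInduction φ ρ σ φ0 φ1 φsucc x with comprehension φ ρ σ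
  ... | X , defX = to x (induction X (from 𝟎 φ0) (from 𝟏 φ1) closed x)
    where
    to   = λ y → Equivalence.to (defX y)
    from = λ y → Equivalence.from (defX y)
    closed : ∀ y → y ∈ X → (y · 𝟎 ∈ X) × (y · 𝟏 ∈ X)
    closed y y∈X with φsucc y (to y y∈X)
    ... | φy0 , φy1 = from (y · 𝟎) φy0 , from (y · 𝟏) φy1

  letter : Bool → W
  letter false = 𝟎
  letter true  = 𝟏

  sameLastLetter : ∀ x y b c → x · letter b ≡ y · letter c → b ≡ c
  sameLastLetter x y false false _ = refl
  sameLastLetter x y false true  e = ⊥-elim (reading x y e)
  sameLastLetter x y true  false e = ⊥-elim (reading y x (sym e))
  sameLastLetter x y true  true  _ = refl

  peelLast : ∀ x y b c → x · letter b ≡ y · letter c → (b ≡ c) × (x ≡ y)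
  peelLast x y b c e with sameLastLetter x y b c e
  ... | refl = refl , simplify x (letter b) y (letter b) e refl

  data LastLetterView (x : W) : Set where
    single : ∀ c → x ≡ letter c → LastLetterView x
    snoc   : ∀ z c → x ≡ z · letter c → LastLetterView x

  shapeF : Formula 1 0
  shapeF = eqW (var zero) c0 or (eqW (var zero) c1 or
             exW (eqW (var (suc zero)) (app (var zero) c0)
               or eqW (var (suc zero)) (app (var zero) c1)))

  lastLetterView : ∀ x → LastLetterView x
  lastLetterView x = fromShape (formulaInduction shapeF [] []
    (inj₁ refl) (inj₂ (inj₁ refl))
    (λ y _ → inj₂ (inj₂ (y , inj₁ refl)) , inj₂ (inj₂ (y , inj₂ refl))) x)
    where
    fromShape : ⟦ shapeF ⟧ (x ∷ []) [] → LastLetterView x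
    fromShape (inj₁ e)                    = single false e
    fromShape (inj₂ (inj₁ e))             = single true e
    fromShape (inj₂ (inj₂ (z , inj₁ e))) = snoc z false e
    fromShape (inj₂ (inj₂ (z , inj₂ e))) = snoc z true e

  Comparable : W → W → Set
  Comparable u v = IsSuffix M u v ⊎ IsSuffix M v u

  comparableSnoc : ∀ u v c → Comparable u v → Comparable (u · c) (v · c)
  comparableSnoc u v c (inj₁ (inj₁ refl))       = inj₁ (inj₁ refl)
  comparableSnoc u v c (inj₁ (inj₂ (t , refl))) = inj₁ (inj₂ (t , assoc t u c))
  comparableSnoc u v c (inj₂ (inj₁ refl))       = inj₂ (inj₁ refl)
  comparableSnoc u v c (inj₂ (inj₂ (t , refl))) = inj₂ (inj₂ (t , assoc t v c))

  SuffixClaim : W → Set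
  SuffixClaim x₂ = ∀ x₁ y₁ y₂ → x₁ · x₂ ≡ y₁ · y₂ → Comparable x₂ y₂

  -- "v is a suffix of u" for word variables i (= u) and j (= v).
  suffixF : ∀ {n m} → Fin n → Fin n → Formula n m
  suffixF i j = eqW (var j) (var i) or exW (eqW (var (suc j)) (app (var zero) (var (suc i))))

  suffixClaimF : Formula 1 0
  suffixClaimF = allW (allW (allW
    (eqW (app (var x₁) (var x₂)) (app (var y₁) (var y₂))
      imp (suffixF x₂ y₂ or suffixF y₂ x₂))))
    where
    y₂ y₁ x₁ x₂ : Fin 4
    y₂ = zero
    y₁ = suc zero
    x₁ = suc (suc zero)
    x₂ = suc (suc (suc zero))

  claimLetter : ∀ c → SuffixClaim (letter c)
  claimLetter c x₁ y₁ y₂ e with lastLetterView y₂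
  ... | single d refl with peelLast x₁ y₁ c d e
  ...   | refl , _ = inj₁ (inj₁ refl)
  claimLetter c x₁ y₁ y₂ e | snoc z d refl
    with peelLast x₁ (y₁ · z) c d (trans e (sym (assoc y₁ z (letter d))))
  ...   | refl , _ = inj₁ (inj₂ (z , refl))

  claimSnoc : ∀ w c → SuffixClaim w → SuffixClaim (w · letter c)
  claimSnoc w c ih x₁ y₁ y₂ e with lastLetterView y₂
  ... | single d refl with peelLast (x₁ · w) y₁ c d (trans (assoc x₁ w (letter c)) e)
  ...   | refl , _ = inj₂ (inj₂ (w , refl))
  claimSnoc w c ih x₁ y₁ y₂ e | snoc z d refl
    with peelLast (x₁ · w) (y₁ · z) c d
           (trans (assoc x₁ w (letter c)) (trans e (sym (assoc y₁ z (letter d)))))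
  ...   | refl , x₁w≡y₁z = comparableSnoc w z (letter c) (ih x₁ y₁ z x₁w≡y₁z)

  suffixClaim : ∀ x₂ → SuffixClaim x₂
  suffixClaim = formulaInduction suffixClaimF [] []
    (claimLetter false) (claimLetter true)
    (λ w ih → claimSnoc w false ih , claimSnoc w true ih)

mainTheorem14 : (M : Structure) → IsModel M →
    ∀ (x₁ x₂ y₁ y₂ : Structure.W M) →
    Structure._·_ M x₁ x₂ ≡ Structure._·_ M y₁ y₂ →
    IsSuffix M x₂ y₂ ⊎ IsSuffix M y₂ x₂
mainTheorem14 M model x₁ x₂ y₁ y₂ = suffixClaim M model x₂ x₁ y₁ y₂
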